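{- Let $G=(V,E)$ be a finite, simple, connected graph with $n$ vertices and $m$ edges, and let $\mu=m-n+1$. If $\mu>0$, then $$\frac{1}{2}\left(\frac{\mu^2}{n-1}-\mu\right)<\cap(G).$$
   Context: For a spanning tree $T=(V,E')$ of $G$, edges of $E'$ are tree-edges and edges of $E\setminus E'$ are cycle-edges; $uTv$ is the unique $u$–$v$ path in $T$. A cycle-edge $f=(v,w)$ determines the tree-cycle $vTw\cup\{f\}$. $\cap_G(T)$ is the number of unordered pairs of distinct cycle-edges whose tree-cycles share at least one edge. $\cap(G)$ is the minimum of $\cap_G(T)$ over all spanning trees $T$ of $G$. -}

module Defs where

open import Data.Nat as ℕ using (ℕ; zero; suc; _∸_)
open import Data.Integer as ℤ using (ℤ; +_)
open import Data.Rational as ℚ using (ℚ)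
open import Data.Bool using (Bool; true; false)
open import Data.Fin using (Fin) renaming (_<_ to _<ᶠ_)
open import Data.Product using (Σ; Σ-syntax; _×_; _,_; ∃; ∃-syntax)
open import Data.Sum using (_⊎_)
open import Data.Unit using (⊤)
open import Data.Empty using (⊥)
open import Data.Maybe using (just)
open import Data.List using (List; []; _∷_; length; head; last)
open import Data.List.Membership.Propositional using (_∈_)
open import Data.List.Relation.Unary.Unique.Propositional using (Unique)
open import Relation.Nullary using (¬_)
open import Relation.Binary.PropositionalEquality using (_≡_)
open import Function.Bundles using (_⇔_)

Rel : ℕ → Set
Rel n = Fin n → Fin n → Bool

Adj : ∀ {n} → Rel n → Fin n → Fin n → Set
Adj R x y = R x y ≡ true

record SimpleGraph (n : ℕ) : Set where
  field
    adj    : Rel n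
    sym    : ∀ x y → adj x y ≡ adj y x
    irrefl : ∀ x → adj x x ≡ false
open SimpleGraph public

-- Cardinality of a (not necessarily proposition-valued) predicate:
-- a duplicate-free list enumerating exactly the elements satisfying P,
-- of length k.
HasCard : {A : Set} → (A → Set) → ℕ → Set
HasCard {A} P k =
  Σ[ xs ∈ List A ] Unique xs × (∀ x → (x ∈ xs) ⇔ P x) × length xs ≡ k

Pair : ℕ → Set
Pair n = Fin n × Fin n

-- an (undirected) edge {x,y} of R is represented by the pair (x , y), x < y
IsEdge : ∀ {n} → Rel n → Pair n → Set
IsEdge R (x , y) = (x <ᶠ y) × Adj R x y

NumEdges : ∀ {n} → SimpleGraph n → ℕ → Set
NumEdges G m = HasCard (IsEdge (adj G)) m

SameEdge : ∀ {n} → Pair n → Pair n → Set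
SameEdge (a , b) (c , d) = (a ≡ c × b ≡ d) ⊎ (a ≡ d × b ≡ c)

Chain : ∀ {n} → Rel n → List (Fin n) → Set
Chain R []           = ⊤
Chain R (x ∷ [])     = ⊤
Chain R (x ∷ y ∷ xs) = Adj R x y × Chain R (y ∷ xs)

record Path {n} (R : Rel n) (u v : Fin n) : Set where
  constructor path
  field
    verts  : List (Fin n)
    first  : head verts ≡ just u
    final  : last verts ≡ just v
    chain  : Chain R verts
    unique : Unique verts
open Path public

EdgeOf : ∀ {n} → Pair n → List (Fin n) → Set
EdgeOf e []           = ⊥
EdgeOf e (x ∷ [])     = ⊥
EdgeOf e (x ∷ y ∷ xs) = SameEdge e (x , y) ⊎ EdgeOf e (y ∷ xs)

record Cycle {n} (R : Rel n) : Set where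
  field
    verts  : List (Fin n)
    long   : 3 ℕ.≤ length verts
    chain  : Chain R verts
    unique : Unique verts
    closed : ∀ x y → head verts ≡ just x → last verts ≡ just y → Adj R y x

Connected : ∀ {n} → Rel n → Set
Connected R = ∀ u v → Path R u v

record SpanningTree {n} (G : SimpleGraph n) : Set where
  field
    tree      : Rel n
    tsym      : ∀ x y → tree x y ≡ tree y x
    subgraph  : ∀ x y → Adj tree x y → Adj (adj G) x y
    connected : Connected tree
    acyclic   : ¬ Cycle tree
open SpanningTree public

CycleEdge : ∀ {n} {G : SimpleGraph n} → SpanningTree G → Pair n → Set
CycleEdge {G = G} T (v , w) = IsEdge (adj G) (v , w) × ¬ Adj (tree T) v w

InTreeCycle : ∀ {n} {G : SimpleGraph n} → SpanningTree G → Pair n → Pair n → Set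
InTreeCycle T (v , w) e =
  SameEdge e (v , w) ⊎ Σ[ p ∈ Path (tree T) v w ] EdgeOf e (verts p)

-- strict lexicographic order on pairs (to pick unordered pairs {f,g})
LexLt : ∀ {n} → Pair n → Pair n → Set
LexLt (a , b) (c , d) = (a <ᶠ c) ⊎ (a ≡ c × b <ᶠ d)

IntersectingPair : ∀ {n} {G : SimpleGraph n} → SpanningTree G → Pair n × Pair n → Set
IntersectingPair {n} T (f , g) =
  CycleEdge T f × CycleEdge T g × LexLt f g ×
  Σ[ e ∈ Pair n ] (InTreeCycle T f e × InTreeCycle T g e)

CapT : ∀ {n} {G : SimpleGraph n} → SpanningTree G → ℕ → Set
CapT T k = HasCard (IntersectingPair T) k

CapG : ∀ {n} → SimpleGraph n → ℕ → Set
CapG G k =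
  Σ[ T ∈ SpanningTree G ] CapT T k ×
  (∀ (T' : SpanningTree G) k' → CapT T' k' → k ℕ.≤ k')

-- rational division by a natural number, with the convention q / 0 = 0
-- (only used where the denominator is provably nonzero)

_÷ℕ_ : ℚ → ℕ → ℚ
q ÷ℕ zero  = ℚ.0ℚ
q ÷ℕ suc d = q ℚ.* (+ 1 ℚ./ suc d)

-- Fix a spanning tree T with ∩_G(T) = k. Seen from an end v, a cycle-edge vw leaves v along the
-- first edge v → u of the tree path vTw; let load(v, u) count the cycle-edges at v leaving along v → u.
-- Then Σ load = D is the number of ends of cycle-edges, D ≥ 2μ because T has at most n − 1 edges,
-- and Σ load² = D + 2Q, where Q counts pairs of cycle-edges at a common vertex leaving it along the
-- same tree edge. The tree-cycles of such a pair share that edge, and the pair determines its common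
-- vertex, so Q ≤ k. The load lives on the directed tree edges other than the one from the stem of a
-- leaf into the leaf, at most 2(n − 1) − 1 of them, so Cauchy–Schwarz gives D² ≤ (2n − 3)(D + 2k),
-- which rearranges to μ² < (n − 1)(μ + 2k).

module Submission where

open import Defs hiding (sym)

-- Imports are local to this module: its ℕ operators would clash with the ℤ ones in lemma8's statement.
module _ where

  open import Data.Bool as Bool using (Bool; true; false; _∧_; _∨_; not; if_then_else_)
  open import Data.Bool.Properties using (∧-identityʳ; ∧-zeroʳ; ∧-conicalˡ; ∨-zeroʳ)
  open import Data.Fin using (Fin; zero; suc)
  import Data.Fin as Fin
  import Data.Fin.Properties as Fin
  open import Data.List using (List; []; _∷_; length; map; head; last; reverseAcc)
  open import Data.List.Membership.Propositional using (_∈_; _∉_)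
  open import Data.List.Membership.Propositional.Properties using (∈-map⁺)
  open import Data.List.Properties using (length-map)
  open import Data.List.Relation.Unary.All using (All; []; _∷_)
  open import Data.List.Relation.Unary.All.Properties using (All¬⇒¬Any; ¬Any⇒All¬)
  open import Data.List.Relation.Unary.AllPairs using ([]; _∷_)
  open import Data.List.Relation.Unary.Any using (here; there)
  open import Data.List.Relation.Unary.Unique.Propositional using (Unique)
  open import Data.Maybe using (just)
  open import Data.Nat as ℕ using (ℕ; zero; suc; pred; _+_; _*_; _∸_; _≤_; _<_; z≤n; s≤s; _≤?_; NonZero)
  open import Data.Nat.Properties hiding (_≟_; _<?_)
  open import Data.Nat.Tactic.RingSolver using (solve-∀)
  open import Algebra.Properties.Semiring.Sum +-*-semiring
    using (sum; sum-syntax; sum-cong-≗; sum-replicate-zero; ∑-distrib-+; ∑-comm; *-distribˡ-sum; *-distribʳ-sum)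
  open import Data.Product using (_×_; _,_; proj₁; proj₂; Σ-syntax)
  open import Data.Product.Properties using (≡-dec; ,-injectiveˡ; ,-injectiveʳ)
  open import Data.Sum using (_⊎_; inj₁; inj₂; [_,_]′)
  open import Data.Unit using (tt)
  open import Function using (_∘_)
  open import Function.Bundles using (Equivalence)
  open import Relation.Binary.Definitions using (DecidableEquality; tri<; tri≈; tri>)
  open import Relation.Binary.PropositionalEquality
    using (_≡_; _≢_; refl; sym; trans; cong; cong₂; subst; subst₂; module ≡-Reasoning)
  open import Relation.Nullary using (Dec; yes; no; ¬_; does; contradiction)
  open import Relation.Nullary.Decidable using (dec-true; dec-false; _×-dec_; _⊎-dec_; ¬?; decidable-stable)

  -- Opaque so that `with x <? y` can abstract it inside indicators [ x <? y ].
  opaque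
    _<?_ : ∀ {n} (x y : Fin n) → Dec (x Fin.< y)
    _<?_ = Fin._<?_

  ⟦_⟧ : Bool → ℕ
  ⟦ true ⟧  = 1
  ⟦ false ⟧ = 0

  [_] : ∀ {P : Set} → Dec P → ℕ
  [ d ] = ⟦ does d ⟧

  []-yes : ∀ {P : Set} (d : Dec P) → P → [ d ] ≡ 1
  []-yes d p = cong ⟦_⟧ (dec-true d p)

  []-no : ∀ {P : Set} (d : Dec P) → ¬ P → [ d ] ≡ 0
  []-no d ¬p = cong ⟦_⟧ (dec-false d ¬p)

  [≟]-sym : ∀ {A : Set} (_≟_ : DecidableEquality A) x y → [ x ≟ y ] ≡ [ y ≟ x ]
  [≟]-sym _≟_ x y with x ≟ y
  ... | yes x≡y = sym ([]-yes (y ≟ x) (sym x≡y))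
  ... | no  x≢y = sym ([]-no (y ≟ x) (x≢y ∘ sym))

  ⟦⟧-≤1 : ∀ b → ⟦ b ⟧ ≤ 1
  ⟦⟧-≤1 true  = s≤s z≤n
  ⟦⟧-≤1 false = z≤n

  record Summation (A : Set) : Set where
    field
      _≟_          : DecidableEquality A
      ∑            : (A → ℕ) → ℕ
      ∑-cong       : ∀ {f g} → (∀ x → f x ≡ g x) → ∑ f ≡ ∑ g
      ∑-+          : ∀ f g → ∑ (λ x → f x + g x) ≡ ∑ f + ∑ g
      *-∑          : ∀ c f → c * ∑ f ≡ ∑ (λ x → c * f x)
      ∑-mono       : ∀ {f g} → (∀ x → f x ≤ g x) → ∑ f ≤ ∑ g
      ∑-sift       : ∀ a (g : A → ℕ) → ∑ (λ x → [ x ≟ a ] * g x) ≡ g a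

    ∑-zero : ∑ (λ _ → 0) ≡ 0
    ∑-zero = sym (*-∑ 0 (λ _ → 0))

    ∑-point : ∀ a → ∑ (λ x → [ x ≟ a ]) ≡ 1
    ∑-point a = trans (∑-cong (λ x → sym (*-identityʳ [ x ≟ a ]))) (∑-sift a (λ _ → 1))

    occ : A → List A → ℕ
    occ x []       = 0
    occ x (y ∷ ys) = [ x ≟ y ] + occ x ys

    ∑-occ : ∀ ys → ∑ (λ x → occ x ys) ≡ length ys
    ∑-occ []       = ∑-zero
    ∑-occ (y ∷ ys) = trans (∑-+ _ _) (cong₂ _+_ (∑-point y) (∑-occ ys))

    occ-∉ : ∀ {x ys} → x ∉ ys → occ x ys ≡ 0
    occ-∉ {ys = []}     _   = refl
    occ-∉ {ys = y ∷ ys} x∉ = cong₂ _+_ ([]-no (_ ≟ y) (x∉ ∘ here)) (occ-∉ (x∉ ∘ there))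

    occ-∈ : ∀ {x ys} → x ∈ ys → 1 ≤ occ x ys
    occ-∈ {x} (here refl) = ≤-trans (≤-reflexive (sym ([]-yes (x ≟ x) refl))) (m≤m+n _ _)
    occ-∈ {x} {y ∷ _} (there x∈) = ≤-trans (occ-∈ x∈) (m≤n+m _ [ x ≟ y ])

    occ-unique : ∀ {x ys} → Unique ys → x ∈ ys → occ x ys ≡ 1
    occ-unique {x} (y∉ ∷ _) (here refl) =
      cong₂ _+_ ([]-yes (x ≟ x) refl) (occ-∉ (All¬⇒¬Any y∉))
    occ-unique {x} {y ∷ _} (y∉ ∷ u) (there x∈) =
      cong₂ _+_ ([]-no (x ≟ y) (λ { refl → All¬⇒¬Any y∉ x∈ })) (occ-unique u x∈)

    occ-≤1 : ∀ {x ys} → Unique ys → occ x ys ≤ 1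
    occ-≤1 {ys = []}     _          = z≤n
    occ-≤1 {x} {y ∷ ys} (y∉ ∷ u) with x ≟ y
    ... | yes refl = ≤-reflexive (cong suc (occ-∉ (All¬⇒¬Any y∉)))
    ... | no  _    = occ-≤1 u

    length≤∑1 : ∀ {xs} → Unique xs → length xs ≤ ∑ (λ _ → 1)
    length≤∑1 {xs} u = subst (_≤ ∑ (λ _ → 1)) (∑-occ xs) (∑-mono (λ x → occ-≤1 u))

  ∑-mono-≤ : ∀ {n} {f g : Fin n → ℕ} → (∀ i → f i ≤ g i) → sum f ≤ sum g
  ∑-mono-≤ {zero}  _   = z≤n
  ∑-mono-≤ {suc n} f≤g = +-mono-≤ (f≤g zero) (∑-mono-≤ (f≤g ∘ suc))

  term≤∑ : ∀ {n} (f : Fin n → ℕ) i → f i ≤ sum f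
  term≤∑ f zero    = m≤m+n (f zero) _
  term≤∑ f (suc i) = ≤-trans (term≤∑ (f ∘ suc) i) (m≤n+m _ (f zero))

  ∑-sift-Fin : ∀ {n} (a : Fin n) (g : Fin n → ℕ) → ∑[ x < n ] ([ x Fin.≟ a ] * g x) ≡ g a
  ∑-sift-Fin {suc n} zero    g = begin
    g zero + 0 + ∑[ x < n ] 0 ≡⟨ cong₂ _+_ (+-identityʳ (g zero)) (sum-replicate-zero n) ⟩
    g zero + 0                ≡⟨ +-identityʳ (g zero) ⟩
    g zero                    ∎
    where open ≡-Reasoning
  ∑-sift-Fin {suc n} (suc a) g = ∑-sift-Fin a (g ∘ suc)

  finSummation : ∀ n → Summation (Fin n)
  finSummation n = record
    { _≟_    = Fin._≟_
    ; ∑      = sum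
    ; ∑-cong = sum-cong-≗
    ; ∑-+    = ∑-distrib-+
    ; *-∑    = *-distribˡ-sum
    ; ∑-mono = ∑-mono-≤
    ; ∑-sift = ∑-sift-Fin
    }

  module _ {A B : Set} (SA : Summation A) (SB : Summation B) where
    private
      module A = Summation SA
      module B = Summation SB

    [≡-dec] : ∀ x y a b → [ ≡-dec A._≟_ B._≟_ (x , y) (a , b) ] ≡ [ x A.≟ a ] * [ y B.≟ b ]
    [≡-dec] x y a b = by-cases (x A.≟ a) (y B.≟ b)
      where
      d = ≡-dec A._≟_ B._≟_ (x , y) (a , b)
      by-cases : Dec (x ≡ a) → Dec (y ≡ b) → [ d ] ≡ [ x A.≟ a ] * [ y B.≟ b ]
      by-cases (yes x≡a) (yes y≡b) =
        trans ([]-yes d (cong₂ _,_ x≡a y≡b)) (sym (cong₂ _*_ ([]-yes (x A.≟ a) x≡a) ([]-yes (y B.≟ b) y≡b)))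
      by-cases (yes _)   (no y≢b)  =
        trans ([]-no d (y≢b ∘ ,-injectiveʳ))
              (sym (trans (cong ([ x A.≟ a ] *_) ([]-no (y B.≟ b) y≢b)) (*-zeroʳ [ x A.≟ a ])))
      by-cases (no x≢a)  _         =
        trans ([]-no d (x≢a ∘ ,-injectiveˡ)) (sym (cong (_* [ y B.≟ b ]) ([]-no (x A.≟ a) x≢a)))

    _⊗_ : Summation (A × B)
    _⊗_ = record
      { _≟_    = ≡-dec A._≟_ B._≟_
      ; ∑      = ∑
      ; ∑-cong = λ f≗g → A.∑-cong (λ a → B.∑-cong (λ b → f≗g (a , b)))
      ; ∑-+    = λ f g → trans (A.∑-cong (λ a → B.∑-+ _ _)) (A.∑-+ _ _)
      ; *-∑    = λ c f → trans (A.*-∑ c _) (A.∑-cong (λ a → B.*-∑ c _))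
      ; ∑-mono = λ f≤g → A.∑-mono (λ a → B.∑-mono (λ b → f≤g (a , b)))
      ; ∑-sift = sift
      }
      where
      ∑ : (A × B → ℕ) → ℕ
      ∑ f = A.∑ (λ a → B.∑ (λ b → f (a , b)))

      sift : ∀ p (g : A × B → ℕ) → ∑ (λ q → [ ≡-dec A._≟_ B._≟_ q p ] * g q) ≡ g p
      sift (a , b) g = begin
        ∑ (λ q → [ ≡-dec A._≟_ B._≟_ q (a , b) ] * g q)
          ≡⟨ A.∑-cong (λ x → B.∑-cong (λ y → trans (cong (_* g (x , y)) ([≡-dec] x y a b))
                                                   (*-assoc [ x A.≟ a ] [ y B.≟ b ] _))) ⟩
        A.∑ (λ x → B.∑ (λ y → [ x A.≟ a ] * ([ y B.≟ b ] * g (x , y))))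
          ≡⟨ A.∑-cong (λ x → sym (B.*-∑ [ x A.≟ a ] _)) ⟩
        A.∑ (λ x → [ x A.≟ a ] * B.∑ (λ y → [ y B.≟ b ] * g (x , y)))
          ≡⟨ A.∑-sift a _ ⟩
        B.∑ (λ y → [ y B.≟ b ] * g (a , y))
          ≡⟨ B.∑-sift b _ ⟩
        g (a , b) ∎
        where open ≡-Reasoning

  m*m≤n*n⇒m≤n : ∀ x y → x * x ≤ y * y → x ≤ y
  m*m≤n*n⇒m≤n x y x²≤y² with x ≤? y
  ... | yes x≤y = x≤y
  ... | no  x≰y = contradiction x²≤y² (<⇒≱ (*-mono-< y<x y<x))
    where y<x = ≰⇒> x≰y

  4*m*n≤[m+n]² : ∀ m n → 4 * (m * n) ≤ (m + n) * (m + n)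
  4*m*n≤[m+n]² m n = [ ordered m n , (λ n≤m → subst₂ _≤_ (cong (4 *_) (*-comm n m)) (cong (λ z → z * z) (+-comm n m))
                                                      (ordered n m n≤m)) ]′ (≤-total m n)
    where
    ordered : ∀ m n → m ≤ n → 4 * (m * n) ≤ (m + n) * (m + n)
    ordered m n m≤n with d , refl ← m≤n⇒∃[o]m+o≡n m≤n =
      subst (4 * (m * (m + d)) ≤_) (sym (expand m d)) (m≤m+n _ (d * d))
      where
      expand : ∀ m d → (m + (m + d)) * (m + (m + d)) ≡ 4 * (m * (m + d)) + d * d
      expand = solve-∀

  cauchy-schwarz-+ : ∀ {s₁ s₂ b₁ b₂ q₁ q₂} → s₁ * s₁ ≤ b₁ * q₁ → s₂ * s₂ ≤ b₂ * q₂ →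
           (s₁ + s₂) * (s₁ + s₂) ≤ (b₁ + b₂) * (q₁ + q₂)
  cauchy-schwarz-+ {s₁} {s₂} {b₁} {b₂} {q₁} {q₂} h₁ h₂ = begin
    (s₁ + s₂) * (s₁ + s₂)                   ≡⟨ square-+ s₁ s₂ ⟩
    s₁ * s₁ + s₂ * s₂ + 2 * (s₁ * s₂)       ≤⟨ +-mono-≤ (+-mono-≤ h₁ h₂) cross ⟩
    b₁ * q₁ + b₂ * q₂ + (b₁ * q₂ + b₂ * q₁) ≡⟨ product-+ b₁ b₂ q₁ q₂ ⟩
    (b₁ + b₂) * (q₁ + q₂)                   ∎
    where
    open ≤-Reasoning
    square-+ : ∀ x y → (x + y) * (x + y) ≡ x * x + y * y + 2 * (x * y)
    square-+ = solve-∀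
    product-+ : ∀ a b c d → a * c + b * d + (a * d + b * c) ≡ (a + b) * (c + d)
    product-+ = solve-∀
    regroup₁ : ∀ x y → (2 * (x * y)) * (2 * (x * y)) ≡ 4 * ((x * x) * (y * y))
    regroup₁ = solve-∀
    regroup₂ : ∀ a b c d → 4 * ((a * b) * (c * d)) ≡ 4 * ((a * d) * (c * b))
    regroup₂ = solve-∀
    cross : 2 * (s₁ * s₂) ≤ b₁ * q₂ + b₂ * q₁
    cross = m*m≤n*n⇒m≤n _ _ (begin
      (2 * (s₁ * s₂)) * (2 * (s₁ * s₂)) ≡⟨ regroup₁ s₁ s₂ ⟩
      4 * ((s₁ * s₁) * (s₂ * s₂))       ≤⟨ *-monoʳ-≤ 4 (*-mono-≤ h₁ h₂) ⟩
      4 * ((b₁ * q₁) * (b₂ * q₂))       ≡⟨ regroup₂ b₁ q₁ b₂ q₂ ⟩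
      4 * ((b₁ * q₂) * (b₂ * q₁))       ≤⟨ 4*m*n≤[m+n]² (b₁ * q₂) (b₂ * q₁) ⟩
      (b₁ * q₂ + b₂ * q₁) * (b₁ * q₂ + b₂ * q₁) ∎)

  ∑-cauchy-schwarz : ∀ {n} (s b q : Fin n → ℕ) → (∀ i → s i * s i ≤ b i * q i) →
           sum s * sum s ≤ sum b * sum q
  ∑-cauchy-schwarz {zero}  _ _ _ _ = z≤n
  ∑-cauchy-schwarz {suc n} s b q h =
    cauchy-schwarz-+ {s zero} {sum (s ∘ suc)} {b zero} {sum (b ∘ suc)} {q zero}
      (h zero) (∑-cauchy-schwarz (s ∘ suc) (b ∘ suc) (q ∘ suc) (h ∘ suc))

  ∑*∑ : ∀ {n} (f g : Fin n → ℕ) → sum f * sum g ≡ ∑[ x < n ] ∑[ y < n ] (f x * g y)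
  ∑*∑ f g = trans (*-distribʳ-sum (sum g) f) (sum-cong-≗ (λ x → *-distribˡ-sum (f x) g))

  ∑-ones : ∀ n → ∑[ x < n ] 1 ≡ n
  ∑-ones zero    = refl
  ∑-ones (suc n) = cong suc (∑-ones n)

  Unique⇒length≤ : ∀ {n} {xs : List (Fin n)} → Unique xs → length xs ≤ n
  Unique⇒length≤ {n} {xs} u = subst (length xs ≤_) (∑-ones n) (Summation.length≤∑1 (finSummation n) u)

  ∑∑-cong : ∀ {m n} {f g : Fin m → Fin n → ℕ} → (∀ x y → f x y ≡ g x y) →
            ∑[ x < m ] ∑[ y < n ] f x y ≡ ∑[ x < m ] ∑[ y < n ] g x y
  ∑∑-cong f≡g = sum-cong-≗ (λ x → sum-cong-≗ (f≡g x))

  ∑∑-+ : ∀ {m n} (f g : Fin m → Fin n → ℕ) →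
         ∑[ x < m ] ∑[ y < n ] (f x y + g x y) ≡ ∑[ x < m ] ∑[ y < n ] f x y + ∑[ x < m ] ∑[ y < n ] g x y
  ∑∑-+ f g = trans (sum-cong-≗ (λ x → ∑-distrib-+ (f x) (g x))) (∑-distrib-+ (λ x → sum (f x)) (λ x → sum (g x)))

  [<]+[≟]+[>] : ∀ {n} (x y : Fin n) → [ x <? y ] + [ y Fin.≟ x ] + [ y <? x ] ≡ 1
  [<]+[≟]+[>] x y with Fin.<-cmp x y
  ... | tri< x<y x≢y y≮x
    rewrite []-yes (x <? y) x<y | []-no (y Fin.≟ x) (x≢y ∘ sym) | []-no (y <? x) y≮x = refl
  ... | tri≈ x≮y x≡y y≮x
    rewrite []-no (x <? y) x≮y | []-yes (y Fin.≟ x) (sym x≡y) | []-no (y <? x) y≮x = refl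
  ... | tri> x≮y x≢y y<x
    rewrite []-no (x <? y) x≮y | []-no (y Fin.≟ x) (x≢y ∘ sym) | []-yes (y <? x) y<x = refl

  ∑∑-symmetric : ∀ {n} (h : Fin n → Fin n → ℕ) → (∀ x y → h x y ≡ h y x) →
    ∑[ x < n ] ∑[ y < n ] h x y ≡ ∑[ x < n ] h x x + 2 * ∑[ x < n ] ∑[ y < n ] ([ x <? y ] * h x y)
  ∑∑-symmetric {n} h h-sym = begin
    ∑∑ h
      ≡⟨ ∑∑-cong (λ x y → sym (trans (cong (_* h x y) ([<]+[≟]+[>] x y)) (*-identityˡ (h x y)))) ⟩
    ∑∑ (λ x y → ([ x <? y ] + [ y Fin.≟ x ] + [ y <? x ]) * h x y)
      ≡⟨ ∑∑-cong (λ x y → distrib [ x <? y ] [ y Fin.≟ x ] [ y <? x ] (h x y)) ⟩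
    ∑∑ (λ x y → [ x <? y ] * h x y + [ y Fin.≟ x ] * h x y + [ y <? x ] * h x y)
      ≡⟨ trans (∑∑-+ (λ x y → [ x <? y ] * h x y + [ y Fin.≟ x ] * h x y) (λ x y → [ y <? x ] * h x y))
               (cong (_+ ∑∑ (λ x y → [ y <? x ] * h x y))
                     (∑∑-+ (λ x y → [ x <? y ] * h x y) (λ x y → [ y Fin.≟ x ] * h x y))) ⟩
    U + ∑∑ (λ x y → [ y Fin.≟ x ] * h x y) + ∑∑ (λ x y → [ y <? x ] * h x y)
      ≡⟨ cong₂ (λ d l → U + d + l) (sum-cong-≗ (λ x → ∑-sift-Fin x (h x))) lower≡upper ⟩
    U + ∑[ x < n ] h x x + U
      ≡⟨ rearrange U (∑[ x < n ] h x x) ⟩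
    ∑[ x < n ] h x x + 2 * U ∎
    where
    open ≡-Reasoning
    ∑∑ : (Fin n → Fin n → ℕ) → ℕ
    ∑∑ f = ∑[ x < n ] ∑[ y < n ] f x y
    U = ∑∑ (λ x y → [ x <? y ] * h x y)
    distrib : ∀ a b c d → (a + b + c) * d ≡ a * d + b * d + c * d
    distrib = solve-∀
    rearrange : ∀ u d → u + d + u ≡ d + 2 * u
    rearrange = solve-∀
    lower≡upper : ∑∑ (λ x y → [ y <? x ] * h x y) ≡ U
    lower≡upper = trans (∑-comm (λ x y → [ y <? x ] * h x y))
                        (∑∑-cong (λ y x → cong ([ y <? x ] *_) (h-sym x y)))

  module Undirected {n} (R : Rel n) (R-sym : ∀ x y → R x y ≡ R y x) (R-irrefl : ∀ x → R x x ≡ false) where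

    Adj⇒≢ : ∀ {x y} → Adj R x y → x ≢ y
    Adj⇒≢ {x} Rxy refl with () ← trans (sym (R-irrefl x)) Rxy

    edgeSum : (Fin n → ℕ) → ℕ
    edgeSum w = ∑[ x < n ] ∑[ y < n ] (w x * w y * ⟦ R x y ⟧)

    degree : (Fin n → ℕ) → Fin n → ℕ
    degree w v = ∑[ y < n ] (w y * ⟦ R v y ⟧)

    edgeSum-insert : ∀ w v → edgeSum (λ x → w x + [ x Fin.≟ v ]) ≡ edgeSum w + 2 * degree w v
    edgeSum-insert w v = begin
      edgeSum (λ x → w x + δ x)
        ≡⟨ ∑∑-cong (λ x y → expand (w x) (w y) (δ x) (δ y) (t x y)) ⟩
      ∑∑ (λ x y → inside x y + from x y + into x y + loop x y)
        ≡⟨ trans (∑∑-+ (λ x y → inside x y + from x y + into x y) loop)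
                 (cong (_+ ∑∑ loop) (trans (∑∑-+ (λ x y → inside x y + from x y) into)
                                           (cong (_+ ∑∑ into) (∑∑-+ inside from)))) ⟩
      edgeSum w + ∑∑ from + ∑∑ into + ∑∑ loop
        ≡⟨ cong₂ _+_ (cong₂ (λ p q → edgeSum w + p + q) ∑from ∑into) ∑loop ⟩
      edgeSum w + degree w v + degree w v + 0
        ≡⟨ rearrange (edgeSum w) (degree w v) ⟩
      edgeSum w + 2 * degree w v ∎
      where
      open ≡-Reasoning
      δ : Fin n → ℕ
      δ x = [ x Fin.≟ v ]
      t : Fin n → Fin n → ℕ
      t x y = ⟦ R x y ⟧
      ∑∑ : (Fin n → Fin n → ℕ) → ℕ
      ∑∑ f = ∑[ x < n ] ∑[ y < n ] f x y
      expand : ∀ p q r s t → (p + r) * (q + s) * t ≡ p * q * t + r * (q * t) + s * (p * t) + r * (s * t)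
      expand = solve-∀
      rearrange : ∀ e d → e + d + d + 0 ≡ e + 2 * d
      rearrange = solve-∀
      sift-outer : ∀ (g : Fin n → Fin n → ℕ) → ∑∑ (λ x y → δ x * g x y) ≡ ∑[ y < n ] g v y
      sift-outer g = trans (sum-cong-≗ (λ x → sym (*-distribˡ-sum (δ x) (g x)))) (∑-sift-Fin v (λ x → sum (g x)))
      inside from into loop : Fin n → Fin n → ℕ
      inside x y = w x * w y * t x y
      from   x y = δ x * (w y * t x y)
      into   x y = δ y * (w x * t x y)
      loop   x y = δ x * (δ y * t x y)
      ∑from : ∑∑ from ≡ degree w v
      ∑from = sift-outer (λ x y → w y * t x y)
      ∑into : ∑∑ into ≡ degree w v
      ∑into = sum-cong-≗ (λ x → trans (∑-sift-Fin v (λ y → w x * t x y)) (cong (λ b → w x * ⟦ b ⟧) (R-sym x v)))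
      ∑loop : ∑∑ loop ≡ 0
      ∑loop = trans (sift-outer (λ x y → δ y * t x y)) (trans (∑-sift-Fin v (t v)) (cong ⟦_⟧ (R-irrefl v)))

    handshake : ∀ {m} → HasCard (IsEdge R) m → ∑[ x < n ] ∑[ y < n ] ⟦ R x y ⟧ ≡ 2 * m
    handshake {m} (es , es-unique , es⇔ , |es|≡m) = begin
      ∑[ x < n ] ∑[ y < n ] ⟦ R x y ⟧
        ≡⟨ ∑∑-symmetric (λ x y → ⟦ R x y ⟧) (λ x y → cong ⟦_⟧ (R-sym x y)) ⟩
      ∑[ x < n ] ⟦ R x x ⟧ + 2 * ∑[ x < n ] ∑[ y < n ] ([ x <? y ] * ⟦ R x y ⟧)
        ≡⟨ cong₂ (λ d e → d + 2 * e) (trans (sum-cong-≗ (cong ⟦_⟧ ∘ R-irrefl)) (sum-replicate-zero n))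
                                     (∑∑-cong occ-es) ⟩
      2 * S₂.∑ (λ e → S₂.occ e es)
        ≡⟨ cong (2 *_) (trans (S₂.∑-occ es) |es|≡m) ⟩
      2 * m ∎
      where
      open ≡-Reasoning
      module S₂ = Summation (finSummation n ⊗ finSummation n)
      occ-es : ∀ x y → [ x <? y ] * ⟦ R x y ⟧ ≡ S₂.occ (x , y) es
      occ-es x y with x <? y | R x y in Rxy
      ... | yes x<y | true  = sym (S₂.occ-unique es-unique (Equivalence.from (es⇔ (x , y)) (x<y , Rxy)))
      ... | yes _   | false =
        sym (S₂.occ-∉ (λ e∈ → contradiction (trans (sym Rxy) (proj₂ (Equivalence.to (es⇔ (x , y)) e∈))) λ ()))
      ... | no x≮y  | _     = sym (S₂.occ-∉ (λ e∈ → x≮y (proj₁ (Equivalence.to (es⇔ (x , y)) e∈))))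

  prefixTo : ∀ {A : Set} {z : A} (xs : List A) → z ∈ xs → List A
  prefixTo (x ∷ _)  (here _)  = x ∷ []
  prefixTo (x ∷ xs) (there z∈) = x ∷ prefixTo xs z∈

  module _ {A : Set} where

    prefixTo-nonempty : ∀ {z : A} xs (z∈ : z ∈ xs) → 1 ≤ length (prefixTo xs z∈)
    prefixTo-nonempty (_ ∷ _) (here _)  = s≤s z≤n
    prefixTo-nonempty (_ ∷ _) (there _) = s≤s z≤n

    last-prefixTo : ∀ {z : A} x xs (z∈ : z ∈ xs) → last (x ∷ prefixTo xs z∈) ≡ just z
    last-prefixTo x (y ∷ _)  (here refl) = refl
    last-prefixTo x (y ∷ ys) (there z∈)  = last-prefixTo y ys z∈

    All-prefixTo : ∀ {P : A → Set} {z} xs (z∈ : z ∈ xs) → All P xs → All P (prefixTo xs z∈)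
    All-prefixTo (_ ∷ _)  (here _)   (p ∷ _)  = p ∷ []
    All-prefixTo (_ ∷ xs) (there z∈) (p ∷ ps) = p ∷ All-prefixTo xs z∈ ps

    Unique-prefixTo : ∀ {z} xs (z∈ : z ∈ xs) → Unique xs → Unique (prefixTo xs z∈)
    Unique-prefixTo (_ ∷ _)  (here _)   (_ ∷ _)    = [] ∷ []
    Unique-prefixTo (_ ∷ xs) (there z∈) (x∉ ∷ u) = All-prefixTo xs z∈ x∉ ∷ Unique-prefixTo xs z∈ u

  Chain-prefixTo : ∀ {n} {R : Rel n} {z} x xs (z∈ : z ∈ xs) → Chain R (x ∷ xs) → Chain R (x ∷ prefixTo xs z∈)
  Chain-prefixTo x (y ∷ _)  (here _)   (r , _) = r , tt
  Chain-prefixTo x (y ∷ ys) (there z∈) (r , c) = r , Chain-prefixTo y ys z∈ c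

  module Forest {n} (R : Rel n) (R-sym : ∀ x y → R x y ≡ R y x) (R-irrefl : ∀ x → R x x ≡ false)
                (acyclic : ¬ Cycle R) where

    open Undirected R R-sym R-irrefl
    open import Data.List.Membership.DecPropositional (Fin._≟_ {n}) using (_∈?_)

    no-chord : ∀ x y rest {z} → Chain R (x ∷ y ∷ rest) → Unique (x ∷ y ∷ rest) → z ∈ rest → ¬ Adj R x z
    no-chord x y rest (Rxy , c) (x∉ ∷ y∉ ∷ u) z∈ Rxz = acyclic record
      { verts  = x ∷ y ∷ prefixTo rest z∈
      ; long   = s≤s (s≤s (prefixTo-nonempty rest z∈))
      ; chain  = Rxy , Chain-prefixTo y rest z∈ c
      ; unique = All-prefixTo (y ∷ rest) (there z∈) x∉ ∷ All-prefixTo rest z∈ y∉ ∷ Unique-prefixTo rest z∈ u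
      ; closed = closed
      }
      where
      closed : ∀ a b → head (x ∷ y ∷ prefixTo rest z∈) ≡ just a →
               last (x ∷ y ∷ prefixTo rest z∈) ≡ just b → Adj R b a
      closed a b refl last≡b with refl ← trans (sym last≡b) (last-prefixTo y rest z∈) = trans (R-sym _ x) Rxz

    record Leaf (U : Fin n → Bool) : Set where
      field
        leaf stem       : Fin n
        leaf∈U          : U leaf ≡ true
        stem∈U          : U stem ≡ true
        leaf-stem       : Adj R leaf stem
        stem-unique     : ∀ w → U w ≡ true → Adj R leaf w → w ≡ stem

    -- Extends the path backwards inside U; by no-chord it never revisits a vertex, so it stops at a leaf.
    walk : ∀ U fuel x y rest → n < fuel + length (x ∷ y ∷ rest) → Chain R (x ∷ y ∷ rest) →
           Unique (x ∷ y ∷ rest) → All (λ w → U w ≡ true) (x ∷ y ∷ rest) → Leaf U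
    walk U zero x y rest n<len _ u _ = contradiction (Unique⇒length≤ u) (<⇒≱ n<len)
    walk U (suc fuel) x y rest n<len c u (Ux ∷ Uy ∷ U-rest)
      with Fin.any? (λ w → (U w Bool.≟ true) ×-dec (R x w Bool.≟ true) ×-dec ¬? (w Fin.≟ y))
    ... | no no-other = record
      { leaf = x ; stem = y ; leaf∈U = Ux ; stem∈U = Uy ; leaf-stem = proj₁ c
      ; stem-unique = λ w Uw Rxw → decidable-stable (w Fin.≟ y) (λ w≢y → no-other (w , Uw , Rxw , w≢y))
      }
    ... | yes (w , Uw , Rxw , w≢y) with w ∈? (x ∷ y ∷ rest)
    ...   | yes (here w≡x)           = contradiction (sym w≡x) (Adj⇒≢ Rxw)
    ...   | yes (there (here w≡y))   = contradiction w≡y w≢y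
    ...   | yes (there (there w∈))   = contradiction Rxw (no-chord x y rest c u w∈)
    ...   | no w∉ = walk U fuel w x (y ∷ rest) (subst (n <_) (sym (+-suc fuel _)) n<len)
                         (trans (R-sym w x) Rxw , c) (¬Any⇒All¬ _ w∉ ∷ u) (Uw ∷ Ux ∷ Uy ∷ U-rest)

    find-leaf : ∀ U {x y} → U x ≡ true → U y ≡ true → Adj R x y → Leaf U
    find-leaf U {x} {y} Ux Uy Rxy =
      walk U (suc n) x y [] (s≤s (m≤m+n n 2)) (Rxy , tt) ((Adj⇒≢ Rxy ∷ []) ∷ [] ∷ []) (Ux ∷ Uy ∷ [])

    size : (Fin n → Bool) → ℕ
    size U = ∑[ x < n ] ⟦ U x ⟧

    _∖_ : (Fin n → Bool) → Fin n → (Fin n → Bool)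
    (U ∖ v) x = U x ∧ not (does (x Fin.≟ v))

    ⟦∖⟧ : ∀ U {v} → U v ≡ true → ∀ x → ⟦ U x ⟧ ≡ ⟦ (U ∖ v) x ⟧ + [ x Fin.≟ v ]
    ⟦∖⟧ U {v} Uv x with x Fin.≟ v
    ... | yes refl rewrite Uv = refl
    ... | no  _    rewrite ∧-identityʳ (U x) = sym (+-identityʳ ⟦ U x ⟧)

    ∖-⊆ : ∀ U v x → (U ∖ v) x ≡ true → U x ≡ true
    ∖-⊆ U v x = ∧-conicalˡ (U x) _

    ∖-keeps : ∀ U {v x} → x ≢ v → (U ∖ v) x ≡ U x
    ∖-keeps U {v} {x} x≢v rewrite dec-false (x Fin.≟ v) x≢v = ∧-identityʳ (U x)

    size-∖ : ∀ U {v} → U v ≡ true → size U ≡ size (U ∖ v) + 1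
    size-∖ U {v} Uv = begin
      size U
        ≡⟨ sum-cong-≗ (⟦∖⟧ U Uv) ⟩
      ∑[ x < n ] (⟦ (U ∖ v) x ⟧ + [ x Fin.≟ v ])
        ≡⟨ ∑-distrib-+ (λ x → ⟦ (U ∖ v) x ⟧) (λ x → [ x Fin.≟ v ]) ⟩
      size (U ∖ v) + ∑[ x < n ] [ x Fin.≟ v ]
        ≡⟨ cong (size (U ∖ v) +_) (Summation.∑-point (finSummation n) v) ⟩
      size (U ∖ v) + 1 ∎
      where open ≡-Reasoning

    edgeSum-∖ : ∀ U {v} → U v ≡ true →
                edgeSum (⟦_⟧ ∘ U) ≡ edgeSum (⟦_⟧ ∘ (U ∖ v)) + 2 * degree (⟦_⟧ ∘ (U ∖ v)) v
    edgeSum-∖ U {v} Uv =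
      trans (∑∑-cong (λ x y → cong₂ (λ a b → a * b * ⟦ R x y ⟧) (⟦∖⟧ U Uv x) (⟦∖⟧ U Uv y)))
            (edgeSum-insert (⟦_⟧ ∘ (U ∖ v)) v)

    degree-leaf : ∀ {U} (L : Leaf U) → degree (⟦_⟧ ∘ (U ∖ Leaf.leaf L)) (Leaf.leaf L) ≡ 1
    degree-leaf {U} L = trans (sum-cong-≗ only-stem) (Summation.∑-point (finSummation n) stem)
      where
      open Leaf L
      only-stem : ∀ y → ⟦ (U ∖ leaf) y ⟧ * ⟦ R leaf y ⟧ ≡ [ y Fin.≟ stem ]
      only-stem y with y Fin.≟ stem
      ... | yes refl rewrite ∖-keeps U (Adj⇒≢ leaf-stem ∘ sym) | stem∈U | leaf-stem = refl
      ... | no y≢stem with (U ∖ leaf) y in U'y | R leaf y in Rly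
      ...   | true  | true  = contradiction (stem-unique y (∖-⊆ U leaf y U'y) Rly) y≢stem
      ...   | true  | false = refl
      ...   | false | _     = refl

    HasEdge : (Fin n → Bool) → Set
    HasEdge U = Σ[ x ∈ Fin n ] Σ[ y ∈ Fin n ] (U x ≡ true × U y ≡ true × Adj R x y)

    no-edge⇒edgeSum≡0 : ∀ U → ¬ HasEdge U → edgeSum (⟦_⟧ ∘ U) ≡ 0
    no-edge⇒edgeSum≡0 U no-edge = trans (∑∑-cong term≡0) (Summation.∑-zero (finSummation n ⊗ finSummation n))
      where
      term≡0 : ∀ x y → ⟦ U x ⟧ * ⟦ U y ⟧ * ⟦ R x y ⟧ ≡ 0
      term≡0 x y with U x in Ux | U y in Uy | R x y in Rxy
      ... | true  | true  | true  = contradiction (x , y , Ux , Uy , Rxy) no-edge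
      ... | true  | true  | false = refl
      ... | true  | false | _     = refl
      ... | false | _     | _     = refl

    edge? : ∀ U → Dec (HasEdge U)
    edge? U = Fin.any? λ x → Fin.any? λ y → (U x Bool.≟ true) ×-dec (U y Bool.≟ true) ×-dec (R x y Bool.≟ true)

    edgeSum+2≤2*size : ∀ k U → size U ≡ suc k → edgeSum (⟦_⟧ ∘ U) + 2 ≤ 2 * suc k
    edgeSum+2≤2*size k U |U|≡1+k with edge? U
    ... | no no-edge rewrite no-edge⇒edgeSum≡0 U no-edge = *-monoʳ-≤ 2 (s≤s z≤n)
    ... | yes (_ , _ , Ux , Uy , Rxy) = remove-leaf k |U∖leaf|≡k
      where
      L = find-leaf U Ux Uy Rxy
      open Leaf L
      |U∖leaf|≡k : size (U ∖ leaf) ≡ k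
      |U∖leaf|≡k = suc-injective (trans (+-comm 1 (size (U ∖ leaf))) (trans (sym (size-∖ U leaf∈U)) |U|≡1+k))
      stem∈U∖leaf : (U ∖ leaf) stem ≡ true
      stem∈U∖leaf = trans (∖-keeps U (Adj⇒≢ leaf-stem ∘ sym)) stem∈U
      remove-leaf : ∀ k → size (U ∖ leaf) ≡ k → edgeSum (⟦_⟧ ∘ U) + 2 ≤ 2 * suc k
      remove-leaf zero    |U∖leaf|≡0 =
        contradiction (subst₂ _≤_ (cong ⟦_⟧ stem∈U∖leaf) |U∖leaf|≡0 (term≤∑ (⟦_⟧ ∘ (U ∖ leaf)) stem)) λ ()
      remove-leaf (suc k) |U∖leaf|≡1+k = begin
        edgeSum (⟦_⟧ ∘ U) + 2
          ≡⟨ cong (_+ 2) (trans (edgeSum-∖ U leaf∈U)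
                                (cong (λ d → edgeSum (⟦_⟧ ∘ (U ∖ leaf)) + 2 * d) (degree-leaf L))) ⟩
        edgeSum (⟦_⟧ ∘ (U ∖ leaf)) + 2 + 2
          ≤⟨ +-monoˡ-≤ 2 (edgeSum+2≤2*size k (U ∖ leaf) |U∖leaf|≡1+k) ⟩
        2 * suc k + 2
          ≡⟨ double-suc k ⟩
        2 * suc (suc k) ∎
        where
        open ≤-Reasoning
        double-suc : ∀ k → 2 * suc k + 2 ≡ 2 * suc (suc k)
        double-suc = solve-∀

    edges+2≤2n : .{{_ : NonZero n}} → ∑[ x < n ] ∑[ y < n ] ⟦ R x y ⟧ + 2 ≤ 2 * n
    edges+2≤2n = subst₂ _≤_ (cong (_+ 2) (∑∑-cong (λ x y → *-identityˡ ⟦ R x y ⟧))) (cong (2 *_) (suc-pred n))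
      (edgeSum+2≤2*size (pred n) (λ _ → true) (trans (∑-ones n) (sym (suc-pred n))))

  SameEdge-swap : ∀ {n} {e : Pair n} {x y} → SameEdge e (x , y) → SameEdge e (y , x)
  SameEdge-swap (inj₁ (a≡x , b≡y)) = inj₂ (a≡x , b≡y)
  SameEdge-swap (inj₂ (a≡y , b≡x)) = inj₁ (a≡y , b≡x)

  module _ {A : Set} where

    head-reverseAcc : ∀ (x : A) xs acc → head (reverseAcc (x ∷ acc) xs) ≡ last (x ∷ xs)
    head-reverseAcc x []       acc = refl
    head-reverseAcc x (y ∷ ys) acc = head-reverseAcc y ys (x ∷ acc)

    last-reverseAcc : ∀ (x : A) xs acc → last (reverseAcc (x ∷ acc) xs) ≡ last (x ∷ acc)
    last-reverseAcc x []       acc = refl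
    last-reverseAcc x (y ∷ ys) acc = last-reverseAcc y ys (x ∷ acc)

    Unique-reverseAcc : ∀ (xs acc : List A) → Unique xs → Unique acc → (∀ {z} → z ∈ xs → z ∉ acc) →
                        Unique (reverseAcc acc xs)
    Unique-reverseAcc []       acc _          u-acc _        = u-acc
    Unique-reverseAcc (y ∷ ys) acc (y∉ys ∷ u) u-acc disjoint =
      Unique-reverseAcc ys (y ∷ acc) u (¬Any⇒All¬ acc (disjoint (here refl)) ∷ u-acc) disjoint′
      where
      disjoint′ : ∀ {z} → z ∈ ys → z ∉ y ∷ acc
      disjoint′ z∈ys (here refl) = All¬⇒¬Any y∉ys z∈ys
      disjoint′ z∈ys (there z∈acc) = disjoint (there z∈ys) z∈acc

  module _ {n} {R : Rel n} (R-sym : ∀ x y → R x y ≡ R y x) where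

    Chain-reverseAcc : ∀ x xs acc → Chain R (x ∷ xs) → Chain R (x ∷ acc) → Chain R (reverseAcc (x ∷ acc) xs)
    Chain-reverseAcc x []       acc _          c-acc = c-acc
    Chain-reverseAcc x (y ∷ ys) acc (Rxy , c) c-acc = Chain-reverseAcc y ys (x ∷ acc) c (trans (R-sym y x) Rxy , c-acc)

    EdgeOf-reverseAcc : ∀ (e : Pair n) x xs acc → EdgeOf e (x ∷ xs) ⊎ EdgeOf e (x ∷ acc) →
                        EdgeOf e (reverseAcc (x ∷ acc) xs)
    EdgeOf-reverseAcc e x []       acc (inj₂ e∈acc)       = e∈acc
    EdgeOf-reverseAcc e x (y ∷ ys) acc (inj₁ (inj₁ e≈xy)) =
      EdgeOf-reverseAcc e y ys (x ∷ acc) (inj₂ (inj₁ (SameEdge-swap e≈xy)))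
    EdgeOf-reverseAcc e x (y ∷ ys) acc (inj₁ (inj₂ e∈ys)) = EdgeOf-reverseAcc e y ys (x ∷ acc) (inj₁ e∈ys)
    EdgeOf-reverseAcc e x (y ∷ ys) acc (inj₂ e∈acc)       = EdgeOf-reverseAcc e y ys (x ∷ acc) (inj₂ (inj₂ e∈acc))

    reversePath : ∀ {u v} (p : Path R u v) → Σ[ q ∈ Path R v u ] (∀ e → EdgeOf e (verts p) → EdgeOf e (verts q))
    reversePath (path []       () _ _ _)
    reversePath (path (x ∷ xs) first final chain unique) =
      path (reverseAcc (x ∷ []) xs) (trans (head-reverseAcc x xs []) final) (trans (last-reverseAcc x xs []) first)
           (Chain-reverseAcc x xs [] chain tt) (Unique-reverseAcc (x ∷ xs) [] unique [] (λ _ ()))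
      , λ e e∈p → EdgeOf-reverseAcc e x xs [] (inj₁ e∈p)

  module _ {n : ℕ} where

    ≮∧≢⇒> : ∀ {v w : Fin n} → ¬ v Fin.< w → v ≢ w → w Fin.< v
    ≮∧≢⇒> v≮w v≢w = Fin.≤∧≢⇒< (≮⇒≥ v≮w) (v≢w ∘ sym)

    pair : Fin n → Fin n → Pair n
    pair v w with v <? w
    ... | yes _ = v , w
    ... | no  _ = w , v

    pair-cases : ∀ v w → (pair v w ≡ (v , w) × v Fin.< w) ⊎ (pair v w ≡ (w , v) × ¬ v Fin.< w)
    pair-cases v w with v <? w
    ... | yes v<w = inj₁ (refl , v<w)
    ... | no  v≮w = inj₂ (refl , v≮w)

    pair-< : ∀ {v w} → v Fin.< w → pair v w ≡ (v , w)
    pair-< {v} {w} v<w with pair-cases v w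
    ... | inj₁ (eq , _)   = eq
    ... | inj₂ (_ , v≮w)  = contradiction v<w v≮w

    other : Pair n → Fin n → Fin n
    other (a , b) v = if does (a Fin.≟ v) then b else a

    other-pair : ∀ v w → other (pair v w) v ≡ w
    other-pair v w with pair-cases v w
    ... | inj₁ (eq , _) rewrite eq | dec-true (v Fin.≟ v) refl = refl
    ... | inj₂ (eq , _) rewrite eq with w Fin.≟ v
    ...   | yes refl = refl
    ...   | no  _    = refl

    common : Pair n → Pair n → Fin n
    common (a , b) (c , d) = if does (a Fin.≟ c) ∨ does (a Fin.≟ d) then a else b

    common-pair : ∀ {v w w′} → v ≢ w → w ≢ w′ → common (pair v w) (pair v w′) ≡ v
    common-pair {v} {w} {w′} v≢w w≢w′ with pair-cases v w | pair-cases v w′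
    ... | inj₁ (eq , _) | inj₁ (eq′ , _) rewrite eq | eq′ | dec-true (v Fin.≟ v) refl = refl
    ... | inj₁ (eq , _) | inj₂ (eq′ , _)
      rewrite eq | eq′ | dec-true (v Fin.≟ v) refl | ∨-zeroʳ (does (v Fin.≟ w′)) = refl
    ... | inj₂ (eq , _) | inj₁ (eq′ , _)
      rewrite eq | eq′ | dec-false (w Fin.≟ v) (v≢w ∘ sym) | dec-false (w Fin.≟ w′) w≢w′ = refl
    ... | inj₂ (eq , _) | inj₂ (eq′ , _)
      rewrite eq | eq′ | dec-false (w Fin.≟ v) (v≢w ∘ sym) | dec-false (w Fin.≟ w′) w≢w′ = refl

    pair-sym : ∀ {v w} → v ≢ w → pair w v ≡ pair v w
    pair-sym {v} {w} v≢w with pair-cases v w | pair-cases w v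
    ... | inj₁ (eq , v<w) | inj₁ (_ , w<v)  = contradiction v<w (Fin.<-asym w<v)
    ... | inj₁ (eq , _)   | inj₂ (eq′ , _)  = trans eq′ (sym eq)
    ... | inj₂ (eq , _)   | inj₁ (eq′ , _)  = trans eq′ (sym eq)
    ... | inj₂ (_ , v≮w)  | inj₂ (_ , w≮v)  = contradiction (≮∧≢⇒> v≮w v≢w) w≮v

    corner : Pair n × Pair n → Fin n × Pair n
    corner (f , g) = common f g , pair (other f (common f g)) (other g (common f g))

    corner-pair : ∀ {v w w′} → v ≢ w → w ≢ w′ → corner (pair v w , pair v w′) ≡ (v , pair w w′)
    corner-pair {v} {w} {w′} v≢w w≢w′ rewrite common-pair v≢w w≢w′ | other-pair v w | other-pair v w′ = refl

    LexLt? : ∀ (f g : Pair n) → Dec (LexLt f g)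
    LexLt? (a , b) (c , d) = (a <? c) ⊎-dec ((a Fin.≟ c) ×-dec (b <? d))

    LexLt-connex : ∀ {f g : Pair n} → f ≢ g → ¬ LexLt f g → LexLt g f
    LexLt-connex {a , b} {c , d} f≢g f≮g with Fin.<-cmp a c
    ... | tri< a<c _ _ = contradiction (inj₁ a<c) f≮g
    ... | tri> _ _ c<a = inj₁ c<a
    ... | tri≈ _ refl _ with Fin.<-cmp b d
    ...   | tri< b<d _ _  = contradiction (inj₂ (refl , b<d)) f≮g
    ...   | tri≈ _ refl _ = contradiction refl f≢g
    ...   | tri> _ _ d<b  = inj₂ (refl , d<b)

  second : ∀ {A : Set} → List A → A → A
  second (_ ∷ y ∷ _) _ = y
  second _           d = d

  module _ {n} {R : Rel n} where

    first-step : ∀ {u v} (p : Path R u v) → u ≢ v →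
                 Adj R u (second (verts p) u) × EdgeOf (u , second (verts p) u) (verts p)
    first-step (path []          ()   _    _         _) _
    first-step (path (_ ∷ [])    refl refl _         _) u≢v = contradiction refl u≢v
    first-step (path (_ ∷ _ ∷ _) refl _    (Ruy , _) _) _   = Ruy , inj₁ (inj₁ (refl , refl))

    second≢leaf : ∀ {u w x} (p : Path R u w) → ¬ Adj R u w → x ≢ u → (∀ y → Adj R x y → y ≡ u) →
                  second (verts p) u ≢ x
    second≢leaf (path []              ()   _    _             _) _ _ _
    second≢leaf (path (_ ∷ [])        refl _    _             _) _ x≢u _ u≡x = x≢u (sym u≡x)
    second≢leaf (path (_ ∷ _ ∷ [])    refl refl (Ruw , _)     _) ¬Ruw _ _ _ = ¬Ruw Ruw
    second≢leaf (path (_ ∷ _ ∷ z ∷ _) refl _    (_ , Rxz , _) ((_ ∷ u≢z ∷ _) ∷ _)) _ _ leaf refl =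
      u≢z (sym (leaf z Rxz))

  module _ {n} (G : SimpleGraph n) (T : SpanningTree G) where

    private
      ad tr : Rel n
      ad = adj G
      tr = tree T

    tree-irrefl : ∀ x → tr x x ≡ false
    tree-irrefl x with tr x x in Txx
    ... | false = refl
    ... | true with () ← trans (sym (subgraph T x x Txx)) (irrefl G x)

    open Forest tr (tsym T) tree-irrefl (acyclic T) using (Leaf; find-leaf)
    open Undirected tr (tsym T) tree-irrefl using (Adj⇒≢)
    open Undirected ad (SimpleGraph.sym G) (irrefl G) using () renaming (Adj⇒≢ to adj≢)

    isCycleEdge : Fin n → Fin n → Bool
    isCycleEdge v w = ad v w ∧ not (tr v w)

    isCycleEdge⇒adj : ∀ {v w} → isCycleEdge v w ≡ true → Adj ad v w
    isCycleEdge⇒adj {v} {w} = ∧-conicalˡ (ad v w) _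

    isCycleEdge⇒¬tree : ∀ {v w} → isCycleEdge v w ≡ true → ¬ Adj tr v w
    isCycleEdge⇒¬tree {v} {w} cyc Tvw
      with () ← trans (sym cyc) (trans (cong (λ b → ad v w ∧ not b) Tvw) (∧-zeroʳ (ad v w)))

    next : Fin n → Fin n → Fin n
    next v w = second (verts (connected T v w)) v

    next-step : ∀ {v w} → isCycleEdge v w ≡ true →
                Adj tr v (next v w) × EdgeOf (v , next v w) (verts (connected T v w))
    next-step {v} {w} cyc = first-step (connected T v w) (adj≢ (isCycleEdge⇒adj cyc))

    CycleEdge-pair : ∀ {v w} → isCycleEdge v w ≡ true → CycleEdge T (pair v w)
    CycleEdge-pair {v} {w} cyc with pair-cases v w
    ... | inj₁ (eq , v<w) rewrite eq = (v<w , isCycleEdge⇒adj cyc) , isCycleEdge⇒¬tree cyc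
    ... | inj₂ (eq , v≮w) rewrite eq =
      (≮∧≢⇒> v≮w (adj≢ (isCycleEdge⇒adj cyc)) , trans (SimpleGraph.sym G w v) (isCycleEdge⇒adj cyc)) ,
      isCycleEdge⇒¬tree cyc ∘ trans (tsym T v w)

    InTreeCycle-next : ∀ {v w} → isCycleEdge v w ≡ true → InTreeCycle T (pair v w) (v , next v w)
    InTreeCycle-next {v} {w} cyc with pair-cases v w | reversePath (tsym T) (connected T v w)
    ... | inj₁ (eq , _) | _        rewrite eq = inj₂ (connected T v w , proj₂ (next-step cyc))
    ... | inj₂ (eq , _) | q , p⊆q  rewrite eq = inj₂ (q , p⊆q _ (proj₂ (next-step cyc)))

    intersecting : ∀ {v w w′} → isCycleEdge v w ≡ true → isCycleEdge v w′ ≡ true → w Fin.< w′ →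
                   next v w ≡ next v w′ →
                   Σ[ fg ∈ Pair n × Pair n ] IntersectingPair T fg × corner fg ≡ (v , w , w′)
    intersecting {v} {w} {w′} cyc cyc′ w<w′ same-next = in-order (LexLt? f g)
      where
      f = pair v w
      g = pair v w′
      e = v , next v w
      v≢w  = adj≢ (isCycleEdge⇒adj cyc)
      v≢w′ = adj≢ (isCycleEdge⇒adj cyc′)
      w≢w′ = Fin.<⇒≢ w<w′
      f≢g : f ≢ g
      f≢g f≡g = w≢w′ (trans (sym (other-pair v w)) (trans (cong (λ h → other h v) f≡g) (other-pair v w′)))
      e∈f = InTreeCycle-next cyc
      e∈g = subst (λ x → InTreeCycle T g (v , x)) (sym same-next) (InTreeCycle-next cyc′)
      in-order : Dec (LexLt f g) → Σ[ fg ∈ Pair n × Pair n ] IntersectingPair T fg × corner fg ≡ (v , w , w′)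
      in-order (yes f<g) = (f , g) , (CycleEdge-pair cyc , CycleEdge-pair cyc′ , f<g , e , e∈f , e∈g) ,
                           trans (corner-pair v≢w w≢w′) (cong (v ,_) (pair-< w<w′))
      in-order (no  f≮g) = (g , f) , (CycleEdge-pair cyc′ , CycleEdge-pair cyc , LexLt-connex f≢g f≮g , e , e∈g , e∈f) ,
                           trans (corner-pair v≢w′ (w≢w′ ∘ sym)) (cong (v ,_) (trans (pair-sym w≢w′) (pair-< w<w′)))

    cyc : Fin n → Fin n → ℕ
    cyc v w = ⟦ isCycleEdge v w ⟧

    load : Fin n → Fin n → ℕ
    load v u = ∑[ w < n ] (cyc v w * [ u Fin.≟ next v w ])

    cycleDegree : Fin n → ℕ
    cycleDegree v = ∑[ w < n ] cyc v w

    sameNext : Fin n → Fin n → Fin n → ℕ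
    sameNext v w w′ = cyc v w * cyc v w′ * [ next v w Fin.≟ next v w′ ]

    ∑-load : ∀ v → ∑[ u < n ] load v u ≡ cycleDegree v
    ∑-load v = begin
      ∑[ u < n ] ∑[ w < n ] (cyc v w * [ u Fin.≟ next v w ])
        ≡⟨ ∑-comm (λ u w → cyc v w * [ u Fin.≟ next v w ]) ⟩
      ∑[ w < n ] ∑[ u < n ] (cyc v w * [ u Fin.≟ next v w ])
        ≡⟨ sum-cong-≗ (λ w → sym (*-distribˡ-sum (cyc v w) (λ u → [ u Fin.≟ next v w ]))) ⟩
      ∑[ w < n ] (cyc v w * ∑[ u < n ] [ u Fin.≟ next v w ])
        ≡⟨ sum-cong-≗ (λ w → cong (cyc v w *_) (Summation.∑-point (finSummation n) (next v w))) ⟩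
      ∑[ w < n ] (cyc v w * 1)
        ≡⟨ sum-cong-≗ (λ w → *-identityʳ (cyc v w)) ⟩
      cycleDegree v ∎
      where open ≡-Reasoning

    ∑-load² : ∀ v → ∑[ u < n ] (load v u * load v u) ≡ ∑[ w < n ] ∑[ w′ < n ] sameNext v w w′
    ∑-load² v = begin
      ∑[ u < n ] (load v u * load v u)
        ≡⟨ sum-cong-≗ (λ u → ∑*∑ (via u) (via u)) ⟩
      ∑[ u < n ] ∑[ w < n ] ∑[ w′ < n ] (via u w * via u w′)
        ≡⟨ ∑-comm (λ u w → ∑[ w′ < n ] (via u w * via u w′)) ⟩
      ∑[ w < n ] ∑[ u < n ] ∑[ w′ < n ] (via u w * via u w′)
        ≡⟨ sum-cong-≗ (λ w → ∑-comm (λ u w′ → via u w * via u w′)) ⟩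
      ∑[ w < n ] ∑[ w′ < n ] ∑[ u < n ] (via u w * via u w′)
        ≡⟨ ∑∑-cong both-via ⟩
      ∑[ w < n ] ∑[ w′ < n ] sameNext v w w′ ∎
      where
      open ≡-Reasoning
      via : Fin n → Fin n → ℕ
      via u w = cyc v w * [ u Fin.≟ next v w ]
      regroup : ∀ a b c d → (a * c) * (b * d) ≡ c * (a * b * d)
      regroup = solve-∀
      both-via : ∀ w w′ → ∑[ u < n ] (via u w * via u w′) ≡ sameNext v w w′
      both-via w w′ = trans (sum-cong-≗ (λ u → regroup (cyc v w) (cyc v w′) [ u Fin.≟ next v w ] [ u Fin.≟ next v w′ ]))
                            (∑-sift-Fin (next v w) (λ u → cyc v w * cyc v w′ * [ u Fin.≟ next v w′ ]))

    cycleEnds : ℕ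
    cycleEnds = ∑[ v < n ] cycleDegree v

    forksAt : Fin n → ℕ
    forksAt v = ∑[ w < n ] ∑[ w′ < n ] ([ w <? w′ ] * sameNext v w w′)

    forks : ℕ
    forks = ∑[ v < n ] forksAt v

    ∑∑-load² : ∑[ v < n ] ∑[ u < n ] (load v u * load v u) ≡ cycleEnds + 2 * forks
    ∑∑-load² = begin
      ∑[ v < n ] ∑[ u < n ] (load v u * load v u)
        ≡⟨ sum-cong-≗ ∑-load² ⟩
      ∑[ v < n ] ∑[ w < n ] ∑[ w′ < n ] sameNext v w w′
        ≡⟨ sum-cong-≗ (λ v → ∑∑-symmetric (sameNext v) (sameNext-sym v)) ⟩
      ∑[ v < n ] (∑[ w < n ] sameNext v w w + 2 * forksAt v)
        ≡⟨ ∑-distrib-+ (λ v → ∑[ w < n ] sameNext v w w) (λ v → 2 * forksAt v) ⟩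
      ∑[ v < n ] ∑[ w < n ] sameNext v w w + ∑[ v < n ] (2 * forksAt v)
        ≡⟨ cong₂ _+_ (∑∑-cong sameNext-diag) (sym (*-distribˡ-sum 2 forksAt)) ⟩
      cycleEnds + 2 * forks ∎
      where
      open ≡-Reasoning
      sameNext-sym : ∀ v w w′ → sameNext v w w′ ≡ sameNext v w′ w
      sameNext-sym v w w′ = cong₂ _*_ (*-comm (cyc v w) (cyc v w′)) ([≟]-sym Fin._≟_ (next v w) (next v w′))
      sameNext-diag : ∀ v w → sameNext v w w ≡ cyc v w
      sameNext-diag v w rewrite []-yes (next v w Fin.≟ next v w) refl = idem (isCycleEdge v w)
        where
        idem : ∀ b → ⟦ b ⟧ * ⟦ b ⟧ * 1 ≡ ⟦ b ⟧
        idem true  = refl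
        idem false = refl

    forks≤ : ∀ {k} → CapT T k → forks ≤ k
    forks≤ {k} (ks , _ , ks⇔ , |ks|≡k) = begin
      forks                                    ≤⟨ S₃.∑-mono {f = fork} fork≤occ ⟩
      S₃.∑ (λ t → S₃.occ t (map corner ks))     ≡⟨ S₃.∑-occ (map corner ks) ⟩
      length (map corner ks)                   ≡⟨ length-map corner ks ⟩
      length ks                                ≡⟨ |ks|≡k ⟩
      k                                        ∎
      where
      open ≤-Reasoning
      module S₃ = Summation (finSummation n ⊗ (finSummation n ⊗ finSummation n))
      fork : Fin n × Fin n × Fin n → ℕ
      fork (v , w , w′) = [ w <? w′ ] * sameNext v w w′
      fork≤occ : ∀ t → fork t ≤ S₃.occ t (map corner ks)
      fork≤occ (v , w , w′) with w <? w′ | isCycleEdge v w in cyc | isCycleEdge v w′ in cyc′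
                               | next v w Fin.≟ next v w′
      ... | yes w<w′ | true | true | yes same-next =
        let fg , fg-intersecting , corner≡ = intersecting cyc cyc′ w<w′ same-next
        in S₃.occ-∈ (subst (_∈ map corner ks) corner≡ (∈-map⁺ corner (Equivalence.from (ks⇔ fg) fg-intersecting)))
      ... | no  _    | _     | _     | _    = z≤n
      ... | yes _    | false | _     | _    = z≤n
      ... | yes _    | true  | false | _    = z≤n
      ... | yes _    | true  | true  | no _ = z≤n

    ∑∑-adj≡cycleEnds+tree : ∑[ x < n ] ∑[ y < n ] ⟦ ad x y ⟧ ≡ cycleEnds + ∑[ x < n ] ∑[ y < n ] ⟦ tr x y ⟧
    ∑∑-adj≡cycleEnds+tree = trans (∑∑-cong split) (∑∑-+ cyc (λ x y → ⟦ tr x y ⟧))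
      where
      split : ∀ x y → ⟦ ad x y ⟧ ≡ cyc x y + ⟦ tr x y ⟧
      split x y with ad x y in Gxy | tr x y in Txy
      ... | true  | true  = refl
      ... | true  | false = refl
      ... | false | false = refl
      ... | false | true with () ← trans (sym (subgraph T x y Txy)) Gxy

    module _ (L : Leaf (λ _ → true)) where

      open Leaf L

      -- No tree-cycle leaves the stem towards the leaf, so the directed tree edge (stem , leaf) carries no load.
      usable : Fin n → Fin n → ℕ
      usable v u = ⟦ tr v u ⟧ ∸ [ v Fin.≟ stem ] * [ u Fin.≟ leaf ]

      usable≤1 : ∀ v u → usable v u ≤ 1
      usable≤1 v u = ≤-trans (m∸n≤m ⟦ tr v u ⟧ ([ v Fin.≟ stem ] * [ u Fin.≟ leaf ])) (⟦⟧-≤1 (tr v u))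

      ∑∑-tree≡usable+1 : ∑[ x < n ] ∑[ y < n ] ⟦ tr x y ⟧ ≡ ∑[ x < n ] ∑[ y < n ] usable x y + 1
      ∑∑-tree≡usable+1 = trans (∑∑-cong split) (trans (∑∑-+ usable δ) (cong (∑[ x < n ] ∑[ y < n ] usable x y +_) ∑∑δ))
        where
        δ : Fin n → Fin n → ℕ
        δ v u = [ v Fin.≟ stem ] * [ u Fin.≟ leaf ]
        δ≤tree : ∀ v u → δ v u ≤ ⟦ tr v u ⟧
        δ≤tree v u with v Fin.≟ stem | u Fin.≟ leaf
        ... | yes refl | yes refl = ≤-reflexive (cong ⟦_⟧ (sym (trans (tsym T stem leaf) leaf-stem)))
        ... | yes _    | no _     = z≤n
        ... | no _     | _        = z≤n
        ∑∑δ : ∑[ v < n ] ∑[ u < n ] δ v u ≡ 1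
        ∑∑δ = trans (∑∑-cong (λ v u → sym ([≡-dec] (finSummation n) (finSummation n) v u stem leaf)))
                    (Summation.∑-point (finSummation n ⊗ finSummation n) (stem , leaf))
        split : ∀ v u → ⟦ tr v u ⟧ ≡ usable v u + δ v u
        split v u = sym (m∸n+n≡m (δ≤tree v u))

      via≤usable : ∀ v u w → cyc v w * [ u Fin.≟ next v w ] ≤ usable v u
      via≤usable v u w with isCycleEdge v w in c | u Fin.≟ next v w
      ... | false | _        = z≤n
      ... | true  | no _     = z≤n
      ... | true  | yes refl rewrite proj₁ (next-step c) = ≤-reflexive (sym (cong (1 ∸_) not-stem→leaf))
        where
        not-stem→leaf : [ v Fin.≟ stem ] * [ next v w Fin.≟ leaf ] ≡ 0
        not-stem→leaf with v Fin.≟ stem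
        ... | no _     = refl
        ... | yes refl = cong (1 *_) ([]-no (next stem w Fin.≟ leaf)
          (second≢leaf (connected T stem w) (isCycleEdge⇒¬tree c) (Adj⇒≢ leaf-stem) (λ y → stem-unique y refl)))

      load-usable : ∀ v u → load v u * usable v u ≡ load v u
      load-usable v u with usable v u in eq | usable≤1 v u
      ... | 1           | _        = *-identityʳ (load v u)
      ... | 0           | _        = trans (*-zeroʳ (load v u)) (sym (n≤0⇒n≡0 load≤0))
        where
        load≤0 : load v u ≤ 0
        load≤0 = ≤-trans (∑-mono-≤ {g = λ _ → 0} (λ w → subst (cyc v w * [ u Fin.≟ next v w ] ≤_) eq (via≤usable v u w)))
                         (≤-reflexive (sum-replicate-zero n))
      ... | suc (suc _) | s≤s ()

      cycleEnds²≤ : cycleEnds * cycleEnds ≤ ∑[ v < n ] ∑[ u < n ] usable v u * (cycleEnds + 2 * forks)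
      cycleEnds²≤ =
        subst₂ (λ d q → d * d ≤ ∑[ v < n ] ∑[ u < n ] usable v u * q) (sum-cong-≗ ∑-load) ∑∑-load²
          (∑-cauchy-schwarz (λ v → ∑[ u < n ] load v u) (λ v → ∑[ u < n ] usable v u)
                            (λ v → ∑[ u < n ] (load v u * load v u))
            (λ v → ∑-cauchy-schwarz (load v) (usable v) (λ u → load v u * load v u) (λ u → ≤-reflexive (load²≡ v u))))
        where
        load²≡ : ∀ v u → load v u * load v u ≡ usable v u * (load v u * load v u)
        load²≡ v u = begin
          load v u * load v u                     ≡⟨ cong (_* load v u) (sym (load-usable v u)) ⟩
          load v u * usable v u * load v u       ≡⟨ cong (_* load v u) (*-comm (load v u) (usable v u)) ⟩
          usable v u * load v u * load v u       ≡⟨ *-assoc (usable v u) (load v u) (load v u) ⟩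
          usable v u * (load v u * load v u)     ∎
          where open ≡-Reasoning

    leaf-exists : ∀ {x y : Fin n} → x ≢ y → Leaf (λ _ → true)
    leaf-exists {x} {y} x≢y = find-leaf (λ _ → true) refl refl (proj₁ (first-step (connected T x y) x≢y))

  -- For r ≥ t write r = t + s: D exceeds N by e ≥ 2s + 1, and D(D − N) ≤ 2NQ then bounds s(t + s).
  r²<tr+2tk : ∀ {t r k D N Q} → 1 ≤ r → D + (N + 1) ≡ 2 * (r + t) → N + 1 ≤ 2 * t →
              D * D ≤ N * (D + 2 * Q) → Q ≤ k → r * r < t * r + 2 * t * k
  r²<tr+2tk {t} {r} {k} 1≤r _ _ _ _ with r ℕ.<? t
  ... | yes r<t = ≤-trans (*-monoˡ-< r {{ℕ.>-nonZero 1≤r}} r<t) (m≤m+n (t * r) (2 * t * k))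
  r²<tr+2tk {t} {r} {k} {D} {N} {Q} 1≤r D+N+1≡ N+1≤2t D²≤ Q≤k | no r≮t
    with s , refl ← m≤n⇒∃[o]m+o≡n (≮⇒≥ r≮t) | c , N+1+c≡2t ← m≤n⇒∃[o]m+o≡n N+1≤2t = begin-strict
    (t + s) * (t + s)          ≡⟨ *-distribʳ-+ (t + s) t s ⟩
    t * (t + s) + s * (t + s)  <⟨ +-monoʳ-< (t * (t + s)) s*r<2tk ⟩
    t * (t + s) + 2 * t * k    ∎
    where
    open ≤-Reasoning
    e = 1 + 2 * s + 2 * c
    D≡N+e : D ≡ N + e
    D≡N+e = +-cancelʳ-≡ (N + 1) D (N + e) (begin-equality
      D + (N + 1)              ≡⟨ D+N+1≡ ⟩
      2 * (t + s + t)          ≡⟨ regroup t s ⟩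
      2 * s + 2 * (2 * t)      ≡⟨ cong (λ x → 2 * s + 2 * x) (sym N+1+c≡2t) ⟩
      2 * s + 2 * (N + 1 + c)  ≡⟨ expand s N c ⟩
      N + e + (N + 1)          ∎)
      where
      regroup : ∀ t s → 2 * (t + s + t) ≡ 2 * s + 2 * (2 * t)
      regroup = solve-∀
      expand : ∀ s N c → 2 * s + 2 * (N + 1 + c) ≡ N + (1 + 2 * s + 2 * c) + (N + 1)
      expand = solve-∀
    eD≤2NQ : e * D ≤ 2 * (N * Q)
    eD≤2NQ = +-cancelˡ-≤ (N * D) (e * D) (2 * (N * Q)) (begin
      N * D + e * D        ≡⟨ *-distribʳ-+ D N e ⟨
      (N + e) * D          ≡⟨ cong (_* D) D≡N+e ⟨
      D * D                ≤⟨ D²≤ ⟩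
      N * (D + 2 * Q)      ≡⟨ expand N D Q ⟩
      N * D + 2 * (N * Q)  ∎)
      where
      expand : ∀ N D Q → N * (D + 2 * Q) ≡ N * D + 2 * (N * Q)
      expand = solve-∀
    2r≤D : 2 * (t + s) ≤ D
    2r≤D = begin
      2 * (t + s)              ≤⟨ m≤m+n (2 * (t + s)) c ⟩
      2 * (t + s) + c          ≡⟨ regroup t s c ⟩
      2 * s + 2 * t + c        ≡⟨ cong (λ x → 2 * s + x + c) N+1+c≡2t ⟨
      2 * s + (N + 1 + c) + c  ≡⟨ expand s N c ⟩
      N + e                    ≡⟨ D≡N+e ⟨
      D                        ∎
      where
      regroup : ∀ t s c → 2 * (t + s) + c ≡ 2 * s + 2 * t + c
      regroup = solve-∀
      expand : ∀ s N c → 2 * s + (N + 1 + c) + c ≡ N + (1 + 2 * s + 2 * c)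
      expand = solve-∀
    s*r<2tk : s * (t + s) < 2 * t * k
    s*r<2tk = begin-strict
      s * (t + s)        <⟨ m<n+m (s * (t + s)) 1≤r ⟩
      (1 + s) * (t + s)  ≤⟨ *-monoˡ-≤ (t + s) (s≤s (≤-trans (m≤m+n s (s + 0)) (m≤m+n (2 * s) (2 * c)))) ⟩
      e * (t + s)        ≤⟨ *-cancelˡ-≤ 2 (begin
        2 * (e * (t + s))  ≡⟨ *-assoc 2 e (t + s) ⟨
        2 * e * (t + s)    ≡⟨ cong (_* (t + s)) (*-comm 2 e) ⟩
        e * 2 * (t + s)    ≡⟨ *-assoc e 2 (t + s) ⟩
        e * (2 * (t + s))  ≤⟨ *-monoʳ-≤ e 2r≤D ⟩
        e * D              ≤⟨ eD≤2NQ ⟩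
        2 * (N * Q)        ∎) ⟩
      N * Q              ≤⟨ *-mono-≤ (≤-trans (m≤m+n N 1) N+1≤2t) Q≤k ⟩
      2 * t * k          ∎

  μ²<tμ+2tk : ∀ {t μ k} (G : SimpleGraph (suc (suc t))) → NumEdges G (μ + suc t) → 1 ≤ μ →
              (T : SpanningTree G) → CapT T k → μ * μ < suc t * μ + 2 * suc t * k
  μ²<tμ+2tk {t} {μ} {k} G |E|≡m 1≤μ T |∩|≡k =
    r²<tr+2tk {D = cycleEnds G T} {N} {forks G T} 1≤μ D+N+1≡2m N+1≤2t (cycleEnds²≤ G T L) (forks≤ G T |∩|≡k)
    where
    L = leaf-exists G T {zero} {suc zero} (λ ())
    N = ∑[ v < suc (suc t) ] ∑[ u < suc (suc t) ] usable G T L v u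
    Tt = ∑[ v < suc (suc t) ] ∑[ u < suc (suc t) ] ⟦ tree T v u ⟧
    D+N+1≡2m : cycleEnds G T + (N + 1) ≡ 2 * (μ + suc t)
    D+N+1≡2m = begin
      cycleEnds G T + (N + 1)  ≡⟨ cong (cycleEnds G T +_) (∑∑-tree≡usable+1 G T L) ⟨
      cycleEnds G T + Tt       ≡⟨ ∑∑-adj≡cycleEnds+tree G T ⟨
      _                        ≡⟨ Undirected.handshake (adj G) (SimpleGraph.sym G) (irrefl G) |E|≡m ⟩
      2 * (μ + suc t)          ∎
      where open ≡-Reasoning
    N+1≤2t : N + 1 ≤ 2 * suc t
    N+1≤2t = +-cancelʳ-≤ 2 (N + 1) (2 * suc t)
      (subst₂ (λ a b → a + 2 ≤ b) (∑∑-tree≡usable+1 G T L) (double-suc t)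
              (Forest.edges+2≤2n (tree T) (tsym T) (tree-irrefl G T) (acyclic T)))
      where
      double-suc : ∀ t → 2 * suc (suc t) ≡ 2 * suc t + 2
      double-suc = solve-∀

  module _ where
    open import Data.Integer as ℤ using (ℤ; +_)
    import Data.Integer.Properties as ℤ
    import Data.Integer.Tactic.RingSolver as ℤ-Solver
    open import Data.Rational as ℚ using (ℚ; ½; _/_; toℚᵘ)
    open import Data.Rational.Properties
      using (toℚᵘ-fromℚᵘ; toℚᵘ-homo-*; toℚᵘ-homo-+; toℚᵘ-homo‿-; toℚᵘ-cancel-<)
    open import Data.Rational.Unnormalised as ℚᵘ using (ℚᵘ; mkℚᵘ; *<*; ↥_; ↧_)
    import Data.Rational.Unnormalised.Properties as ℚᵘ

    toℚᵘ-/ : ∀ x d → toℚᵘ (x / suc d) ℚᵘ.≃ mkℚᵘ x d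
    toℚᵘ-/ x d = toℚᵘ-fromℚᵘ (mkℚᵘ x d)

    toℚᵘ-½[-] : ∀ p q → toℚᵘ (½ ℚ.* (p ℚ.- q)) ℚᵘ.≃ mkℚᵘ (+ 1) 1 ℚᵘ.* (toℚᵘ p ℚᵘ.- toℚᵘ q)
    toℚᵘ-½[-] p q = ℚᵘ.≃-trans (toℚᵘ-homo-* ½ (p ℚ.- q))
      (ℚᵘ.*-cong (toℚᵘ-/ (+ 1) 1)
                 (ℚᵘ.≃-trans (toℚᵘ-homo-+ p (ℚ.- q)) (ℚᵘ.+-congʳ (toℚᵘ p) (toℚᵘ-homo‿- q))))

    ½[p÷t-q]<k : ∀ p q t k → p ℤ.- + suc t ℤ.* q ℤ.< + k ℤ.* + (2 * suc t) →
                 ½ ℚ.* ((p / 1) ÷ℕ suc t ℚ.- q / 1) ℚ.< + k / 1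
    ½[p÷t-q]<k p q t k h = toℚᵘ-cancel-< (begin-strict
      toℚᵘ (½ ℚ.* ((p / 1) ÷ℕ suc t ℚ.- q / 1))  ≃⟨ lhs≃ ⟩
      X                                          <⟨ *<* X<k ⟩
      mkℚᵘ (+ k) 0                               ≃⟨ toℚᵘ-/ (+ k) 0 ⟨
      toℚᵘ (+ k / 1)                             ∎)
      where
      open ℚᵘ.≤-Reasoning
      X : ℚᵘ
      X = mkℚᵘ (+ 1) 1 ℚᵘ.* (mkℚᵘ p 0 ℚᵘ.* mkℚᵘ (+ 1) t ℚᵘ.- mkℚᵘ q 0)
      lhs≃ : toℚᵘ (½ ℚ.* ((p / 1) ÷ℕ suc t ℚ.- q / 1)) ℚᵘ.≃ X
      lhs≃ = ℚᵘ.≃-trans (toℚᵘ-½[-] ((p / 1) ÷ℕ suc t) (q / 1))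
        (ℚᵘ.*-congˡ (ℚᵘ.+-cong (ℚᵘ.≃-trans (toℚᵘ-homo-* (p / 1) (+ 1 / suc t))
                                           (ℚᵘ.*-cong (toℚᵘ-/ p 0) (toℚᵘ-/ (+ 1) t)))
                               (ℚᵘ.-‿cong (toℚᵘ-/ q 0))))
      ↥X≡ : ↥ X ≡ p ℤ.- + suc t ℤ.* q
      ↥X≡ = trans (expand p q (+ suc (t + 0))) (cong (λ z → p ℤ.- + suc z ℤ.* q) (+-identityʳ t))
        where
        expand : ∀ p q N → + 1 ℤ.* (p ℤ.* + 1 ℤ.* + 1 ℤ.+ ℤ.- q ℤ.* N) ≡ p ℤ.- N ℤ.* q
        expand = ℤ-Solver.solve-∀
      ↧X≡ : ↧ X ≡ + (2 * suc t)
      ↧X≡ = cong +_ (trans (expand (t + 0)) (cong (λ z → 2 * suc z) (+-identityʳ t)))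
        where
        expand : ∀ a → suc (a * 1 + 1 * suc (a * 1)) ≡ 2 * suc a
        expand = solve-∀
      X<k : ↥ X ℤ.* + 1 ℤ.< + k ℤ.* ↧ X
      X<k = subst₂ (λ a b → a ℤ.* + 1 ℤ.< + k ℤ.* b) (sym ↥X≡) (sym ↧X≡) (subst (ℤ._< _) (sym (ℤ.*-identityʳ _)) h)

    ½[0-q]<k : ∀ q k → + 0 ℤ.< q → ½ ℚ.* (ℚ.0ℚ ℚ.- q / 1) ℚ.< + k / 1
    ½[0-q]<k q k 0<q = ½[p÷t-q]<k (+ 0) q 0 k (ℤ.<-≤-trans -q<0 (subst (+ 0 ℤ.≤_) (ℤ.pos-* k 2) (ℤ.+≤+ z≤n)))
      where
      -q<0 : + 0 ℤ.- + 1 ℤ.* q ℤ.< + 0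
      -q<0 = subst (ℤ._< + 0) (sym (neg q)) (ℤ.neg-mono-< 0<q)
        where
        neg : ∀ q → + 0 ℤ.- + 1 ℤ.* q ≡ ℤ.- q
        neg = ℤ-Solver.solve-∀

    r²<tr+2tk⇒ℤ : ∀ {r t k} → r * r < t * r + 2 * t * k → + r ℤ.* + r ℤ.- + t ℤ.* + r ℤ.< + k ℤ.* + (2 * t)
    r²<tr+2tk⇒ℤ {r} {t} {k} h = begin-strict
      + r ℤ.* + r ℤ.- + t ℤ.* + r                   ≡⟨ cong₂ ℤ._-_ (ℤ.pos-* r r) (ℤ.pos-* t r) ⟨
      + (r * r) ℤ.- + (t * r)                       <⟨ ℤ.+-monoˡ-< (ℤ.- + (t * r)) (ℤ.+<+ h) ⟩
      + (t * r + 2 * t * k) ℤ.- + (t * r)           ≡⟨ cong (ℤ._- + (t * r)) (ℤ.pos-+ (t * r) (2 * t * k)) ⟩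
      + (t * r) ℤ.+ + (2 * t * k) ℤ.- + (t * r)     ≡⟨ cancel (+ (t * r)) (+ (2 * t * k)) ⟩
      + (2 * t * k)                                 ≡⟨ cong +_ (*-comm (2 * t) k) ⟩
      + (k * (2 * t))                               ≡⟨ ℤ.pos-* k (2 * t) ⟩
      + k ℤ.* + (2 * t)                             ∎
      where
      open ℤ.≤-Reasoning
      cancel : ∀ a b → a ℤ.+ b ℤ.- a ≡ b
      cancel = ℤ-Solver.solve-∀

    μ-as-ℕ : ∀ m t → + 0 ℤ.< + m ℤ.- + suc t ℤ.+ + 1 →
             Σ[ r ∈ ℕ ] (+ m ℤ.- + suc t ℤ.+ + 1 ≡ + r) × m ≡ r + t × 1 ≤ r
    μ-as-ℕ m t 0<μ with + m ℤ.- + suc t ℤ.+ + 1 in μ≡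
    ... | + suc r = suc r , refl , ℤ.+-injective (trans (split (+ m) (+ t)) (cong (ℤ._+ + t) μ≡)) , s≤s z≤n
      where
      split : ∀ m t → m ≡ m ℤ.- (+ 1 ℤ.+ t) ℤ.+ + 1 ℤ.+ t
      split = ℤ-Solver.solve-∀
    ... | + zero    with ℤ.+<+ () ← 0<μ
    ... | ℤ.-[1+ _ ] with () ← 0<μ

open import Data.Nat using (ℕ; suc; _∸_)
open import Data.Product using (_,_)
open import Relation.Binary.PropositionalEquality using (refl)
open import Data.Integer using (ℤ; +_; _-_; _+_; _*_) renaming (_<_ to _<ℤ_)
open import Data.Rational using (ℚ; ½; _/_) renaming (_<_ to _<ℚ_; _-_ to _-ℚ_; _*_ to _*ℚ_)

lemma8 : (n m : ℕ) (G : SimpleGraph n) → Connected (adj G) → NumEdges G m →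
           let μ : ℤ
               μ = + m - + n + + 1
           in + 0 <ℤ μ →
              ∀ (k : ℕ) → CapG G k →
              ½ *ℚ (((μ * μ) / 1) ÷ℕ (n ∸ 1) -ℚ (μ / 1)) <ℚ (+ k / 1)
-- For n ≤ 1 the divisor n ∸ 1 is 0, and q ÷ℕ 0 = 0 by convention.
lemma8 0 m G _ _ 0<μ k _ = ½[0-q]<k _ k 0<μ
lemma8 1 m G _ _ 0<μ k _ = ½[0-q]<k _ k 0<μ
lemma8 (suc (suc t)) m G _ |E|≡m 0<μ k (T , |∩T|≡k , _)
  with r , μ≡r , refl , 1≤r ← μ-as-ℕ m (suc t) 0<μ
  rewrite μ≡r =
    ½[p÷t-q]<k (+ r * + r) (+ r) t k (r²<tr+2tk⇒ℤ {r} {suc t} {k} (μ²<tμ+2tk G |E|≡m 1≤r T |∩T|≡k))
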